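{- Let $G$ be any group containing elements $x_1,x_2,\ldots,x_\ell$ such that each $x_k$ ($k=1,\ldots,\ell$) has order $1$ or $2$. Then the factorizations $(x_1,x_2,\ldots,x_\ell)$ and $(x_\ell,\ldots,x_2,x_1)$ have Hurwitz orbits of the same size.
   Context: A factorization is a tuple $(x_1,\ldots,x_\ell)$ of elements of $G$. For $1 \le i \le \ell-1$, the Hurwitz move $\sigma_i$ sends $(x_1,\ldots,x_{i-1},x_i,x_{i+1},x_{i+2},\ldots,x_\ell)$ to $(x_1,\ldots,x_{i-1},x_{i+1},x_{i+1}^{ -1}x_ix_{i+1},x_{i+2},\ldots,x_\ell)$; its inverse $\sigma_i^{ -1}$ sends it to $(x_1,\ldots,x_{i-1},x_ix_{i+1}x_i^{ -1},x_i,x_{i+2},\ldots,x_\ell)$. The Hurwitz orbit of a factorization is the set of all factorizations obtainable from it by applying finite sequences of Hurwitz moves and their inverses; its size is its cardinality. -}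

module Defs where

open import Level using (Level; _⊔_)
open import Data.Nat using (ℕ; suc)
open import Data.Vec using (Vec; _∷_)
open import Data.Product using (Σ; ∃; _×_; proj₁)
open import Algebra.Bundles using (Group)
open import Relation.Binary.Bundles using (Setoid)
open import Relation.Binary.Construct.Closure.ReflexiveTransitive using (Star)
import Data.Vec.Relation.Binary.Pointwise.Inductive as PW
import Relation.Binary.Construct.On as On

module _ {c ℓ : Level} (G : Group c ℓ) where
  open Group G

  HasOrderOneOrTwo : Carrier → Set ℓ
  HasOrderOneOrTwo x = x ∙ x ≈ ε

  data HurwitzStep : {n : ℕ} → Vec Carrier n → Vec Carrier n → Set c where
    σ-here  : ∀ {n} (a b : Carrier) (r : Vec Carrier n) →
              HurwitzStep (a ∷ b ∷ r) (b ∷ ((b ⁻¹) ∙ a ∙ b) ∷ r)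
    σ⁻¹-here : ∀ {n} (a b : Carrier) (r : Vec Carrier n) →
              HurwitzStep (a ∷ b ∷ r) ((a ∙ b ∙ (a ⁻¹)) ∷ a ∷ r)
    there   : ∀ {n} (a : Carrier) {u v : Vec Carrier n} →
              HurwitzStep u v → HurwitzStep (a ∷ u) (a ∷ v)

  InHurwitzOrbit : {n : ℕ} → Vec Carrier n → Vec Carrier n → Set (c ⊔ ℓ)
  InHurwitzOrbit {n} x y =
    ∃ λ z → Star HurwitzStep x z × PW.Pointwise _≈_ z y

  HurwitzOrbit : {n : ℕ} → Vec Carrier n → Setoid (c ⊔ ℓ) (c ⊔ ℓ)
  HurwitzOrbit {n} x =
    On.setoid {B = Σ (Vec Carrier n) (InHurwitzOrbit x)} (PW.setoid setoid n) proj₁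

{-# OPTIONS --safe #-}
module Submission where

open import Defs
open import Level using (Level)
open import Data.Nat using (ℕ)
open import Data.Vec using (Vec; reverse; []; _∷_; _∷ʳ_)
open import Data.Vec.Properties using (reverse-∷)
open import Data.Vec.Relation.Unary.All using (All; []; _∷_)
open import Data.Product using (∃; _×_; _,_; proj₁)
open import Algebra.Bundles using (Group)
open import Function.Base using (id)
open import Function.Bundles using (Inverse)
open import Function.Construct.Composition using (inverse)
open import Relation.Binary.PropositionalEquality as ≡ using (_≡_)
open import Relation.Binary.Construct.Closure.ReflexiveTransitive
  using (ε; _◅_; _◅◅_; gmap)
import Algebra.Properties.Group as GroupProperties
import Data.Vec.Relation.Binary.Equality.Setoid as VecEquality
import Relation.Binary.Reasoning.Setoid as SetoidReasoning

-- The mirror map (x₁, …, xₗ) ↦ (xₗ⁻¹, …, x₁⁻¹) turns the move σᵢ into σₗ₋ᵢ⁻¹ and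
-- σᵢ⁻¹ into σₗ₋ᵢ, so it maps Hurwitz orbits onto Hurwitz orbits; being an
-- involution, it is a bijection between the orbit of x and that of its mirror.
-- When every xₖ satisfies xₖ² = 1 the mirror of x is its reversal.

module HurwitzMirror {c ℓ : Level} (G : Group c ℓ) where
  open Group G hiding (ε)
  open GroupProperties G using (⁻¹-anti-homo-∙; ⁻¹-involutive; inverseˡ-unique)
  open VecEquality setoid using (_≋_; ≋-refl; ≋-sym; ≋-trans; []; _∷_)
  open SetoidReasoning setoid

  ∷ʳ⁺ : ∀ {n} {u v : Vec Carrier n} {a b : Carrier} → u ≋ v → a ≈ b → (u ∷ʳ a) ≋ (v ∷ʳ b)
  ∷ʳ⁺ []        a≈b = a≈b ∷ []
  ∷ʳ⁺ (p ∷ u≋v) a≈b = p ∷ ∷ʳ⁺ u≋v a≈b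

  ⁻¹-anti-homo-∙∙ : ∀ x y z → (x ∙ y ∙ z) ⁻¹ ≈ z ⁻¹ ∙ y ⁻¹ ∙ x ⁻¹
  ⁻¹-anti-homo-∙∙ x y z = begin
    (x ∙ y ∙ z) ⁻¹          ≈⟨ ⁻¹-anti-homo-∙ (x ∙ y) z ⟩
    z ⁻¹ ∙ (x ∙ y) ⁻¹       ≈⟨ ∙-congˡ (⁻¹-anti-homo-∙ x y) ⟩
    z ⁻¹ ∙ (y ⁻¹ ∙ x ⁻¹)    ≈⟨ assoc _ _ _ ⟨
    z ⁻¹ ∙ y ⁻¹ ∙ x ⁻¹      ∎

  HasOrderOneOrTwo⇒⁻¹≈ : ∀ {x} → HasOrderOneOrTwo G x → x ⁻¹ ≈ x
  HasOrderOneOrTwo⇒⁻¹≈ {x} x∙x≈ε = sym (inverseˡ-unique x x x∙x≈ε)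

  mirror : ∀ {n} → Vec Carrier n → Vec Carrier n
  mirror []      = []
  mirror (a ∷ u) = mirror u ∷ʳ a ⁻¹

  mirror-cong : ∀ {n} {u v : Vec Carrier n} → u ≋ v → mirror u ≋ mirror v
  mirror-cong []          = []
  mirror-cong (a≈b ∷ u≋v) = ∷ʳ⁺ (mirror-cong u≋v) (⁻¹-cong a≈b)

  mirror-∷ʳ : ∀ {n} (u : Vec Carrier n) a → mirror (u ∷ʳ a) ≡ a ⁻¹ ∷ mirror u
  mirror-∷ʳ []      a = ≡.refl
  mirror-∷ʳ (b ∷ u) a = ≡.cong (_∷ʳ b ⁻¹) (mirror-∷ʳ u a)

  mirror-involutive : ∀ {n} (u : Vec Carrier n) → mirror (mirror u) ≋ u
  mirror-involutive []      = []
  mirror-involutive (a ∷ u) rewrite mirror-∷ʳ (mirror u) (a ⁻¹) =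
    ⁻¹-involutive a ∷ mirror-involutive u

  mirror≋reverse : ∀ {n} (u : Vec Carrier n) → All (HasOrderOneOrTwo G) u → mirror u ≋ reverse u
  mirror≋reverse []      []       = []
  mirror≋reverse (a ∷ u) (a² ∷ u²) rewrite reverse-∷ a u =
    ∷ʳ⁺ (mirror≋reverse u u²) (HasOrderOneOrTwo⇒⁻¹≈ a²)

  HurwitzStep-transport : ∀ {n} {u u′ v : Vec Carrier n} → u ≋ u′ → HurwitzStep G u v →
                          ∃ λ v′ → HurwitzStep G u′ v′ × v ≋ v′
  HurwitzStep-transport {u′ = a′ ∷ b′ ∷ r′} (a≈ ∷ b≈ ∷ r≈) (σ-here a b r) =
    _ , σ-here a′ b′ r′ , b≈ ∷ ∙-cong (∙-cong (⁻¹-cong b≈) a≈) b≈ ∷ r≈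
  HurwitzStep-transport {u′ = a′ ∷ b′ ∷ r′} (a≈ ∷ b≈ ∷ r≈) (σ⁻¹-here a b r) =
    _ , σ⁻¹-here a′ b′ r′ , ∙-cong (∙-cong a≈ b≈) (⁻¹-cong a≈) ∷ a≈ ∷ r≈
  HurwitzStep-transport {u′ = a′ ∷ _} (a≈ ∷ u≋u′) (there a s) =
    let v′ , s′ , v≋v′ = HurwitzStep-transport u≋u′ s
    in  a′ ∷ v′ , there a′ s′ , a≈ ∷ v≋v′

  ≋⇒InHurwitzOrbit : ∀ {n} {u v : Vec Carrier n} → u ≋ v → InHurwitzOrbit G u v
  ≋⇒InHurwitzOrbit u≋v = _ , ε , u≋v

  InHurwitzOrbit-respˡ : ∀ {n} {u u′ v : Vec Carrier n} → u ≋ u′ → InHurwitzOrbit G u v → InHurwitzOrbit G u′ v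
  InHurwitzOrbit-respˡ u≋u′ (_ , ε , u≋v) = ≋⇒InHurwitzOrbit (≋-trans (≋-sym u≋u′) u≋v)
  InHurwitzOrbit-respˡ u≋u′ (z , s ◅ ss , z≋v) =
    let w′ , s′ , w≋w′   = HurwitzStep-transport u≋u′ s
        z′ , ss′ , z′≋v = InHurwitzOrbit-respˡ w≋w′ (z , ss , z≋v)
    in  z′ , s′ ◅ ss′ , z′≋v

  InHurwitzOrbit-trans : ∀ {n} {u v w : Vec Carrier n} →
                         InHurwitzOrbit G u v → InHurwitzOrbit G v w → InHurwitzOrbit G u w
  InHurwitzOrbit-trans (_ , ss , z≋v) v~w =
    let z′ , ss′ , z′≋w = InHurwitzOrbit-respˡ (≋-sym z≋v) v~w
    in  z′ , ss ◅◅ ss′ , z′≋w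

  HurwitzStep-∷ʳ : ∀ {n} {u v : Vec Carrier n} d → HurwitzStep G u v → HurwitzStep G (u ∷ʳ d) (v ∷ʳ d)
  HurwitzStep-∷ʳ d (σ-here a b r)   = σ-here a b (r ∷ʳ d)
  HurwitzStep-∷ʳ d (σ⁻¹-here a b r) = σ⁻¹-here a b (r ∷ʳ d)
  HurwitzStep-∷ʳ d (there a s)      = there a (HurwitzStep-∷ʳ d s)

  InHurwitzOrbit-∷ʳ : ∀ {n} {u v : Vec Carrier n} d → InHurwitzOrbit G u v →
                      InHurwitzOrbit G (u ∷ʳ d) (v ∷ʳ d)
  InHurwitzOrbit-∷ʳ d (_ , ss , z≋v) = _ , gmap (_∷ʳ d) (HurwitzStep-∷ʳ d) ss , ∷ʳ⁺ z≋v refl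

  σ-last : ∀ {n} (p : Vec Carrier n) x y → HurwitzStep G (p ∷ʳ x ∷ʳ y) (p ∷ʳ y ∷ʳ y ⁻¹ ∙ x ∙ y)
  σ-last []      x y = σ-here x y []
  σ-last (a ∷ p) x y = there a (σ-last p x y)

  σ⁻¹-last : ∀ {n} (p : Vec Carrier n) x y → HurwitzStep G (p ∷ʳ x ∷ʳ y) (p ∷ʳ x ∙ y ∙ x ⁻¹ ∷ʳ x)
  σ⁻¹-last []      x y = σ⁻¹-here x y []
  σ⁻¹-last (a ∷ p) x y = there a (σ⁻¹-last p x y)

  mirror-HurwitzStep : ∀ {n} {u v : Vec Carrier n} → HurwitzStep G u v →
                       InHurwitzOrbit G (mirror u) (mirror v)
  mirror-HurwitzStep (σ-here a b r) =
    _ , σ⁻¹-last (mirror r) (b ⁻¹) (a ⁻¹) ◅ ε ,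
    ∷ʳ⁺ (∷ʳ⁺ ≋-refl (sym (⁻¹-anti-homo-∙∙ (b ⁻¹) a b))) refl
  mirror-HurwitzStep (σ⁻¹-here a b r) =
    _ , σ-last (mirror r) (b ⁻¹) (a ⁻¹) ◅ ε ,
    ∷ʳ⁺ ≋-refl (sym (⁻¹-anti-homo-∙∙ a b (a ⁻¹)))
  mirror-HurwitzStep (there a s) = InHurwitzOrbit-∷ʳ (a ⁻¹) (mirror-HurwitzStep s)

  mirror-InHurwitzOrbit : ∀ {n} {u v : Vec Carrier n} → InHurwitzOrbit G u v →
                          InHurwitzOrbit G (mirror u) (mirror v)
  mirror-InHurwitzOrbit (_ , ε , u≋v)      = ≋⇒InHurwitzOrbit (mirror-cong u≋v)
  mirror-InHurwitzOrbit (z , s ◅ ss , z≋v) =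
    InHurwitzOrbit-trans (mirror-HurwitzStep s) (mirror-InHurwitzOrbit (z , ss , z≋v))

  mirror-HurwitzOrbit : ∀ {n} (x : Vec Carrier n) → Inverse (HurwitzOrbit G x) (HurwitzOrbit G (mirror x))
  mirror-HurwitzOrbit x = record
    { to        = λ (y , x~y) → mirror y , mirror-InHurwitzOrbit x~y
    ; from      = λ (y , mx~y) → mirror y ,
                    InHurwitzOrbit-respˡ (mirror-involutive x) (mirror-InHurwitzOrbit mx~y)
    ; to-cong   = mirror-cong
    ; from-cong = mirror-cong
    ; inverse   = (λ {w} y≋ → ≋-trans (mirror-cong y≋) (mirror-involutive (proj₁ w)))
                , (λ {w} y≋ → ≋-trans (mirror-cong y≋) (mirror-involutive (proj₁ w)))
    }

  HurwitzOrbit-cong : ∀ {n} {x y : Vec Carrier n} → x ≋ y → Inverse (HurwitzOrbit G x) (HurwitzOrbit G y)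
  HurwitzOrbit-cong x≋y = record
    { to        = λ (z , x~z) → z , InHurwitzOrbit-respˡ x≋y x~z
    ; from      = λ (z , y~z) → z , InHurwitzOrbit-respˡ (≋-sym x≋y) y~z
    ; to-cong   = id
    ; from-cong = id
    ; inverse   = id , id
    }

corollary5p2 : ∀ {c ℓ : Level} (G : Group c ℓ) (n : ℕ) (x : Vec (Group.Carrier G) n) →
    All (HasOrderOneOrTwo G) x →
    Inverse (HurwitzOrbit G x) (HurwitzOrbit G (reverse x))
corollary5p2 G n x x² =
  inverse (mirror-HurwitzOrbit x) (HurwitzOrbit-cong (mirror≋reverse x x²))
  where open HurwitzMirror G
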